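{- For all states $(\Gamma_1;\Delta_1)$, $(\Gamma_2;\Delta_2)$ and every formula $A$: if $(\Gamma_1;\Delta_1)\overset{\tau}{\Longrightarrow}(\Gamma_2;\Delta_2)$ and the sequent $\Gamma_2;\Delta_2\vdash A$ is derivable, then $\Gamma_1;\Delta_1\vdash A$ is derivable.
   Context: Formulas: $A,B,C ::= a \mid \mathbf{1} \mid A\otimes B \mid \top \mid A \,\&\, B \mid a \multimap B \mid\ !A$, with $a$ ranging over atomic formulas. Contexts $\Gamma,\Delta$ are finite multisets of formulas; "$\Delta_1,\Delta_2$" is multiset union, "$\cdot$" the empty context. Sequents $\Gamma;\Delta\vdash A$ are derivable by the rules: (init) $\Gamma;a\vdash a$. (clone) from $\Gamma,A;\Delta,A\vdash C$ infer $\Gamma,A;\Delta\vdash C$. ($\otimes$R) from $\Gamma;\Delta_1\vdash A$ and $\Gamma;\Delta_2\vdash B$ infer $\Gamma;\Delta_1,\Delta_2\vdash A\otimes B$. ($\otimes$L) from $\Gamma;\Delta,A,B\vdash C$ infer $\Gamma;\Delta,A\otimes B\vdash C$. ($\mathbf 1$R) $\Gamma;\cdot\vdash\mathbf 1$. ($\mathbf 1$L) from $\Gamma;\Delta\vdash C$ infer $\Gamma;\Delta,\mathbf 1\vdash C$. ($\&$R) from $\Gamma;\Delta\vdash A$ and $\Gamma;\Delta\vdash B$ infer $\Gamma;\Delta\vdash A\&B$. ($\&$L$_i$, $i=1,2$) from $\Gamma;\Delta,A_i\vdash C$ infer $\Gamma;\Delta,A_1\&A_2\vdash C$. ($\top$R)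 $\Gamma;\Delta\vdash\top$ (no left rule for $\top$). ($\multimap$R) from $\Gamma;\Delta,a\vdash B$ infer $\Gamma;\Delta\vdash a\multimap B$. ($\multimap$L) from $\Gamma;\Delta_1\vdash a$ and $\Gamma;\Delta_2,B\vdash C$ infer $\Gamma;\Delta_1,\Delta_2,a\multimap B\vdash C$. (!R) from $\Gamma;\cdot\vdash A$ infer $\Gamma;\cdot\vdash\,!A$. (!L) from $\Gamma,A;\Delta\vdash C$ infer $\Gamma;\Delta,!A\vdash C$. States are pairs $(\Gamma;\Delta)$ modulo structural congruence $\equiv$: $\Delta$ is a multiset and $\Gamma$ a set ($(\Gamma,A,A;\Delta)\equiv(\Gamma,A;\Delta)$); congruent states are identified. Composition: $((\Gamma_1;\Delta_1),(\Gamma_2;\Delta_2)) := (\Gamma_1,\Gamma_2;\Delta_1,\Delta_2)$. Labelled transitions with labels $\tau$, $!a$, $?a$ ($a$ atomic) are generated by: $(\Gamma;\Delta,a)\xrightarrow{!a}(\Gamma;\Delta)$; $(\Gamma;\Delta,a\multimap B)\xrightarrow{?a}(\Gamma;\Delta,B)$; if $S_1\xrightarrow{!a}S_1'$ and $S_2\xrightarrow{?a}S_2'$ then $(S_1,S_2)\xrightarrow{\tau}(S_1',S_2')$; $(\Gamma;\Delta,A\otimes B)\xrightarrow{\tau}(\Gamma;\Delta,A,B)$; $(\Gamma;\Delta,\mathbf 1)\xrightarrow{\tau}(\Gamma;\Delta)$; $(\Gamma;\Delta,A_1\&A_2)\xrightarrow{\tau}(\Gamma;\Delta,A_i)$ for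 $i=1,2$; $(\Gamma;\Delta,!A)\xrightarrow{\tau}(\Gamma,A;\Delta)$; $(\Gamma,A;\Delta)\xrightarrow{\tau}(\Gamma,A;\Delta,A)$ (no rule for $\top$). $\overset{\tau}{\Longrightarrow}$ is the reflexive transitive closure of $\xrightarrow{\tau}$. -}

module Defs where

open import Data.Nat using (ℕ)
open import Data.List using (List; []; _∷_; _++_)
open import Data.List.Membership.Propositional using (_∈_)
open import Data.List.Relation.Binary.Subset.Propositional using (_⊆_)
open import Data.List.Relation.Binary.Permutation.Propositional using (_↭_)
open import Data.Product using (_×_; _,_; Σ; ∃)

Atom : Set
Atom = ℕ

infixr 6 _⊗_
infixr 5 _&_
infixr 4 _⊸_

data Formula : Set where
  atom : Atom → Formula
  𝟏    : Formula
  _⊗_  : Formula → Formula → Formula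
  ⊤    : Formula
  _&_  : Formula → Formula → Formula
  _⊸_  : Atom → Formula → Formula
  !_   : Formula → Formula

-- Contexts are finite multisets, represented by lists; multiset equality
-- is list permutation _↭_.  Multiset union is _++_.
Ctx : Set
Ctx = List Formula

infix 3 _⨾_⊢_

-- Every rule whose conclusion has a linear
-- context built from pieces takes an explicit permutation witness, so that
-- derivability depends on Δ only as a multiset.
data _⨾_⊢_ (Γ : Ctx) : Ctx → Formula → Set where
  init  : ∀ {Δ a} → Δ ↭ (atom a ∷ []) → Γ ⨾ Δ ⊢ atom a
  clone : ∀ {Δ A C} → A ∈ Γ → Γ ⨾ (A ∷ Δ) ⊢ C → Γ ⨾ Δ ⊢ C
  ⊗R    : ∀ {Δ Δ₁ Δ₂ A B} → Δ ↭ (Δ₁ ++ Δ₂) →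
          Γ ⨾ Δ₁ ⊢ A → Γ ⨾ Δ₂ ⊢ B → Γ ⨾ Δ ⊢ A ⊗ B
  ⊗L    : ∀ {Δ Δ' A B C} → Δ' ↭ ((A ⊗ B) ∷ Δ) →
          Γ ⨾ (A ∷ B ∷ Δ) ⊢ C → Γ ⨾ Δ' ⊢ C
  𝟏R    : ∀ {Δ} → Δ ↭ [] → Γ ⨾ Δ ⊢ 𝟏
  𝟏L    : ∀ {Δ Δ' C} → Δ' ↭ (𝟏 ∷ Δ) → Γ ⨾ Δ ⊢ C → Γ ⨾ Δ' ⊢ C
  &R    : ∀ {Δ A B} → Γ ⨾ Δ ⊢ A → Γ ⨾ Δ ⊢ B → Γ ⨾ Δ ⊢ A & B
  &L₁   : ∀ {Δ Δ' A B C} → Δ' ↭ ((A & B) ∷ Δ) →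
          Γ ⨾ (A ∷ Δ) ⊢ C → Γ ⨾ Δ' ⊢ C
  &L₂   : ∀ {Δ Δ' A B C} → Δ' ↭ ((A & B) ∷ Δ) →
          Γ ⨾ (B ∷ Δ) ⊢ C → Γ ⨾ Δ' ⊢ C
  ⊤R    : ∀ {Δ} → Γ ⨾ Δ ⊢ ⊤
  ⊸R    : ∀ {Δ a B} → Γ ⨾ (atom a ∷ Δ) ⊢ B → Γ ⨾ Δ ⊢ a ⊸ B
  ⊸L    : ∀ {Δ Δ₁ Δ₂ a B C} → Δ ↭ ((a ⊸ B) ∷ (Δ₁ ++ Δ₂)) →
          Γ ⨾ Δ₁ ⊢ atom a → Γ ⨾ (B ∷ Δ₂) ⊢ C → Γ ⨾ Δ ⊢ C
  !R    : ∀ {Δ A} → Δ ↭ [] → Γ ⨾ [] ⊢ A → Γ ⨾ Δ ⊢ ! A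
  !L    : ∀ {Δ Δ' A C} → Δ' ↭ ((! A) ∷ Δ) →
          (A ∷ Γ) ⨾ Δ ⊢ C → Γ ⨾ Δ' ⊢ C

State : Set
State = Ctx × Ctx

_∥_ : State → State → State
(Γ₁ , Δ₁) ∥ (Γ₂ , Δ₂) = (Γ₁ ++ Γ₂ , Δ₁ ++ Δ₂)

-- Structural congruence: Γ compared as a set, Δ as a multiset.
_≈S_ : State → State → Set
(Γ , Δ) ≈S (Γ' , Δ') = (Γ ⊆ Γ' × Γ' ⊆ Γ) × Δ ↭ Δ'

data Label : Set where
  τ  : Label
  !ₗ : Atom → Label
  ?ₗ : Atom → Label

data Step : Label → State → State → Set where
  out   : ∀ {Γ Δ a} → Step (!ₗ a) (Γ , atom a ∷ Δ) (Γ , Δ)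
  inp   : ∀ {Γ Δ a B} → Step (?ₗ a) (Γ , (a ⊸ B) ∷ Δ) (Γ , B ∷ Δ)
  comm  : ∀ {S₁ S₁' S₂ S₂' a} → Step (!ₗ a) S₁ S₁' → Step (?ₗ a) S₂ S₂' →
          Step τ (S₁ ∥ S₂) (S₁' ∥ S₂')
  ⊗τ    : ∀ {Γ Δ A B} → Step τ (Γ , (A ⊗ B) ∷ Δ) (Γ , A ∷ B ∷ Δ)
  𝟏τ    : ∀ {Γ Δ} → Step τ (Γ , 𝟏 ∷ Δ) (Γ , Δ)
  &τ₁   : ∀ {Γ Δ A B} → Step τ (Γ , (A & B) ∷ Δ) (Γ , A ∷ Δ)
  &τ₂   : ∀ {Γ Δ A B} → Step τ (Γ , (A & B) ∷ Δ) (Γ , B ∷ Δ)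
  !τ    : ∀ {Γ Δ A} → Step τ (Γ , (! A) ∷ Δ) (A ∷ Γ , Δ)
  cloneτ : ∀ {Γ Δ A} → A ∈ Γ → Step τ (Γ , Δ) (Γ , A ∷ Δ)

-- Transitions on states modulo ≡ (congruent states are identified).
_—[_]→_ : State → Label → State → Set
S —[ ℓ ]→ T = Σ State λ S' → Σ State λ T' → S ≈S S' × Step ℓ S' T' × T' ≈S T

data _⟹τ_ : State → State → Set where
  done : ∀ {S T} → S ≈S T → S ⟹τ T
  more : ∀ {S U T} → S —[ τ ]→ U → U ⟹τ T → S ⟹τ T

-- Each τ-transition is a left rule (or clone) read bottom-up: a synchronisation
-- of a with a ⊸ B is ⊸L whose left premise is init, and ⊗, 𝟏, &, ! and the
-- persistent-context step are ⊗L, 𝟏L, &Lᵢ, !L and clone.  So derivability of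
-- the target of a step yields derivability of its source.  Structural
-- congruence is harmless because derivability is invariant under permuting the
-- linear context and monotone in the persistent one.
module Submission where

open import Defs
open import Data.Product using (_,_)
open import Data.List using ([]; _∷_)
open import Data.List.Relation.Binary.Subset.Propositional using (_⊆_)
open import Data.List.Relation.Binary.Subset.Propositional.Properties using (∷⁺ʳ)
open import Data.List.Relation.Binary.Permutation.Propositional
  using (_↭_; refl; prep; ↭-sym; ↭-trans)
open import Data.List.Relation.Binary.Permutation.Propositional.Properties using (shift)

⊢-resp-↭ : ∀ {Γ Δ Δ' A} → Δ ↭ Δ' → Γ ⨾ Δ ⊢ A → Γ ⨾ Δ' ⊢ A
⊢-resp-↭ q (init p)     = init (↭-trans (↭-sym q) p)
⊢-resp-↭ q (clone m d)  = clone m (⊢-resp-↭ (prep _ q) d)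
⊢-resp-↭ q (⊗R p d e)   = ⊗R (↭-trans (↭-sym q) p) d e
⊢-resp-↭ q (⊗L p d)     = ⊗L (↭-trans (↭-sym q) p) d
⊢-resp-↭ q (𝟏R p)       = 𝟏R (↭-trans (↭-sym q) p)
⊢-resp-↭ q (𝟏L p d)     = 𝟏L (↭-trans (↭-sym q) p) d
⊢-resp-↭ q (&R d e)     = &R (⊢-resp-↭ q d) (⊢-resp-↭ q e)
⊢-resp-↭ q (&L₁ p d)    = &L₁ (↭-trans (↭-sym q) p) d
⊢-resp-↭ q (&L₂ p d)    = &L₂ (↭-trans (↭-sym q) p) d
⊢-resp-↭ q ⊤R           = ⊤R
⊢-resp-↭ q (⊸R d)       = ⊸R (⊢-resp-↭ (prep _ q) d)
⊢-resp-↭ q (⊸L p d e)   = ⊸L (↭-trans (↭-sym q) p) d e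
⊢-resp-↭ q (!R p d)     = !R (↭-trans (↭-sym q) p) d
⊢-resp-↭ q (!L p d)     = !L (↭-trans (↭-sym q) p) d

⊢-weaken : ∀ {Γ Γ' Δ A} → Γ ⊆ Γ' → Γ ⨾ Δ ⊢ A → Γ' ⨾ Δ ⊢ A
⊢-weaken s (init p)     = init p
⊢-weaken s (clone m d)  = clone (s m) (⊢-weaken s d)
⊢-weaken s (⊗R p d e)   = ⊗R p (⊢-weaken s d) (⊢-weaken s e)
⊢-weaken s (⊗L p d)     = ⊗L p (⊢-weaken s d)
⊢-weaken s (𝟏R p)       = 𝟏R p
⊢-weaken s (𝟏L p d)     = 𝟏L p (⊢-weaken s d)
⊢-weaken s (&R d e)     = &R (⊢-weaken s d) (⊢-weaken s e)
⊢-weaken s (&L₁ p d)    = &L₁ p (⊢-weaken s d)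
⊢-weaken s (&L₂ p d)    = &L₂ p (⊢-weaken s d)
⊢-weaken s ⊤R           = ⊤R
⊢-weaken s (⊸R d)       = ⊸R (⊢-weaken s d)
⊢-weaken s (⊸L p d e)   = ⊸L p (⊢-weaken s d) (⊢-weaken s e)
⊢-weaken s (!R p d)     = !R p (⊢-weaken s d)
⊢-weaken s (!L p d)     = !L p (⊢-weaken (∷⁺ʳ _ s) d)

_⊢ˢ_ : State → Formula → Set
(Γ , Δ) ⊢ˢ A = Γ ⨾ Δ ⊢ A

≈S-reflects-⊢ˢ : ∀ {S T A} → S ≈S T → T ⊢ˢ A → S ⊢ˢ A
≈S-reflects-⊢ˢ {_ , _} {_ , _} ((_ , Γ'⊆Γ) , Δ↭Δ') d = ⊢-weaken Γ'⊆Γ (⊢-resp-↭ (↭-sym Δ↭Δ') d)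

Step-τ-reflects-⊢ˢ : ∀ {S T A} → Step τ S T → T ⊢ˢ A → S ⊢ˢ A
Step-τ-reflects-⊢ˢ (comm {a = a} (out {Δ = Δ₁}) (inp {Δ = Δ₂} {B = B})) d =
  ⊸L {Δ₁ = atom a ∷ []} (shift (a ⊸ B) (atom a ∷ Δ₁) Δ₂) (init refl)
     (⊢-resp-↭ (shift B Δ₁ Δ₂) d)
Step-τ-reflects-⊢ˢ ⊗τ         d = ⊗L refl d
Step-τ-reflects-⊢ˢ 𝟏τ         d = 𝟏L refl d
Step-τ-reflects-⊢ˢ &τ₁        d = &L₁ refl d
Step-τ-reflects-⊢ˢ &τ₂        d = &L₂ refl d
Step-τ-reflects-⊢ˢ !τ         d = !L refl d
Step-τ-reflects-⊢ˢ (cloneτ m) d = clone m d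

⟹τ-reflects-⊢ˢ : ∀ {S T A} → S ⟹τ T → T ⊢ˢ A → S ⊢ˢ A
⟹τ-reflects-⊢ˢ (done S≈T) d = ≈S-reflects-⊢ˢ S≈T d
⟹τ-reflects-⊢ˢ (more (_ , _ , S≈S' , step , T'≈U) U⟹T) d =
  ≈S-reflects-⊢ˢ S≈S' (Step-τ-reflects-⊢ˢ step (≈S-reflects-⊢ˢ T'≈U (⟹τ-reflects-⊢ˢ U⟹T d)))

proposition1 : ∀ (Γ₁ Δ₁ Γ₂ Δ₂ : Ctx) (A : Formula) →
    (Γ₁ , Δ₁) ⟹τ (Γ₂ , Δ₂) → Γ₂ ⨾ Δ₂ ⊢ A → Γ₁ ⨾ Δ₁ ⊢ A
proposition1 _ _ _ _ _ = ⟹τ-reflects-⊢ˢ
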